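{- Let $M$ be a closed rooted trivalent map and let $(\,(),t)$ be the (unique up to $\alpha$-equivalence) closed linear lambda term whose underlying rooted trivalent map is isomorphic to $M$. Then $M$ is bridgeless if and only if $t$ is indecomposable.
   Context: Lambda terms are built from variables by application $t(u)$ and abstraction $\lambda x[t]$. A context is a finite ordered list of distinct variables. The relation $\Gamma\vdash t$ is defined inductively by the rules: $x\vdash x$; if $\Gamma\vdash t$ and $\Delta\vdash u$ with disjoint variables then $\Gamma,\Delta\vdash t(u)$; if $\Gamma,x\vdash t$ then $\Gamma\vdash\lambda x[t]$; if $\Gamma,y,x,\Delta\vdash t$ then $\Gamma,x,y,\Delta\vdash t$. A linear lambda term is a pair $(\Gamma,t)$ with $\Gamma\vdash t$; it is closed if $\Gamma$ is empty. Subterms of $(\Gamma,t)$: $(\Gamma,t)$ itself; if $t=t_1(t_2)$ with $\Gamma_1\vdash t_1$, $\Gamma_2\vdash t_2$, every subterm of $(\Gamma_1,t_1)$ or $(\Gamma_2,t_2)$; if $t=\lambda x[t_1]$ with $\Gamma,x\vdash t_1$, every subterm of $((\Gamma,x),t_1)$. Proper subterms are those other than $(\Gamma,t)$ itself. A linear lambda term is decomposable if it has a closed proper subterm, indecomposable otherwise. Let $T=\langle v,e\mid v^3=e^2=1\rangle$. A closed rooted trivalent map is a transitive $T$-set $M$ with a distinguished element $r$ such that the only fixed point of $v$ is $r$ and $e$ has no fixed points. Its underlying graph has as vertices the $v$-orbits and as edges the $e$-orbits $\{m,e(m)\}$, joining the $v$-orbit of $m$ to that of $e(m)$ (loops and multiple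 edges allowed). The root edge is the $e$-orbit of $r$. A bridge is an edge other than the root edge whose removal disconnects the underlying graph; $M$ is bridgeless if it has no bridge. Underlying rooted trivalent map of a linear term $(\Gamma,t)$: for each application occurrence in $t$ take elements $f,a,c$ (function, argument, continuation) with $v(f)=c$, $v(c)=a$, $v(a)=f$; for each abstraction occurrence take elements $\rho,\pi,\beta$ (root, parameter, body) with $v(\rho)=\pi$, $v(\pi)=\beta$, $v(\beta)=\rho$; add an element $r$ with $v(r)=r$. Each subterm occurrence $s$ has a receiving element: $r$ if $s=t$; the function (resp. argument) element of $s'(s'')$ if $s=s'$ (resp. $s''$); the body element of $\lambda x[s]$ if $s$ is its body. Each subterm occurrence other than a free-variable occurrence has a producing element: the continuation element for an application, the root element for an abstraction, and for an occurrence of a bound variable $x$ the parameter element of the abstraction binding $x$. Then $e$ swaps producing and receiving elements of each such occurrence and fixes receiving elements of free-variable occurrences; the root is $r$. Isomorphism of closed rooted trivalent maps: bijection commuting with $v,e$ and preserving the root. -}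

module Defs where

open import Data.Nat using (ℕ; _≟_)
open import Data.List using (List; []; _∷_; _++_; [_])
open import Data.List.Relation.Binary.Disjoint.Propositional using (Disjoint)
open import Data.Maybe using (Maybe; just; nothing)
open import Data.Product using (Σ; ∃; _×_; _,_)
open import Data.Sum using (_⊎_)
open import Relation.Nullary using (¬_; yes; no)
open import Relation.Binary.PropositionalEquality using (_≡_; _≢_)
open import Relation.Binary.Construct.Closure.Equivalence using (EqClosure)
open import Function.Bundles using (_↔_; Inverse)

Var : Set
Var = ℕ

data Term : Set where
  var : Var → Term
  _·_ : Term → Term → Term
  ƛ   : Var → Term → Term

Context : Set
Context = List Var

data _⊢_ : Context → Term → Set where
  ax   : ∀ {x} → [ x ] ⊢ var x
  app  : ∀ {Γ Δ t u} → Γ ⊢ t → Δ ⊢ u → Disjoint Γ Δ → (Γ ++ Δ) ⊢ (t · u)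
  lam  : ∀ {Γ x t} → (Γ ++ [ x ]) ⊢ t → Γ ⊢ ƛ x t
  exch : ∀ {Γ Δ x y t} → (Γ ++ y ∷ x ∷ Δ) ⊢ t → (Γ ++ x ∷ y ∷ Δ) ⊢ t

LinearTerm : Set
LinearTerm = Σ (Context × Term) (λ p → let (Γ , t) = p in Γ ⊢ t)

data Subterm : Context × Term → Context × Term → Set where
  self : ∀ {p} → Subterm p p
  appL : ∀ {Γ Γ₁ Γ₂ t₁ t₂ s} → Γ₁ ⊢ t₁ → Γ₂ ⊢ t₂ →
         Subterm (Γ₁ , t₁) s → Subterm (Γ , (t₁ · t₂)) s
  appR : ∀ {Γ Γ₁ Γ₂ t₁ t₂ s} → Γ₁ ⊢ t₁ → Γ₂ ⊢ t₂ →
         Subterm (Γ₂ , t₂) s → Subterm (Γ , (t₁ · t₂)) s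
  lamB : ∀ {Γ x t₁ s} → (Γ ++ [ x ]) ⊢ t₁ →
         Subterm ((Γ ++ [ x ]) , t₁) s → Subterm (Γ , ƛ x t₁) s

ProperSubterm : Context × Term → Context × Term → Set
ProperSubterm p s = Subterm p s × s ≢ p

Decomposable : Context × Term → Set
Decomposable p = ∃ λ s → ProperSubterm p ([] , s)

Indecomposable : Context × Term → Set
Indecomposable p = ¬ Decomposable p

GenStep : {C : Set} → (C → C) → (C → C) → C → C → Set
GenStep v e x y = (y ≡ v x) ⊎ (y ≡ e x)

record ClosedRootedTrivalentMap : Set₁ where
  field
    Carrier : Set
    v e     : Carrier → Carrier
    v³      : ∀ x → v (v (v x)) ≡ x
    e²      : ∀ x → e (e x) ≡ x
    transitive : ∀ x y → EqClosure (GenStep v e) x y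
    r       : Carrier
    v-fix   : ∀ x → v x ≡ x → x ≡ r
    v-fix-r : v r ≡ r
    e-nofix : ∀ x → e x ≢ x

module _ (M : ClosedRootedTrivalentMap) where
  open ClosedRootedTrivalentMap M

  NotOnEdge : Carrier → Carrier → Set
  NotOnEdge m x = (x ≢ m) × (x ≢ e m)

  StepWithout : Carrier → Carrier → Carrier → Set
  StepWithout m x y = (y ≡ v x) ⊎ ((y ≡ e x) × NotOnEdge m x)

  -- connectivity of the underlying graph after removing the edge {m , e m}
  -- (vertices are v-orbits, so connectivity of elements = of vertices)
  ConnectedWithout : Carrier → Set
  ConnectedWithout m = ∀ x y → EqClosure (StepWithout m) x y

  IsBridge : Carrier → Set
  IsBridge m = NotOnEdge r m × ¬ ConnectedWithout m

  Bridgeless : Set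
  Bridgeless = ∀ m → ¬ IsBridge m

-- The underlying rooted trivalent map of a term.
-- Elements: r (represented by nothing) and, for each application
-- occurrence, f a c; for each abstraction occurrence, ρ π β.

data Node : Term → Set where
  app-f app-a app-c : ∀ {t u} → Node (t · u)
  lam-ρ lam-π lam-β : ∀ {x t} → Node (ƛ x t)
  inL : ∀ {t u} → Node t → Node (t · u)
  inR : ∀ {t u} → Node u → Node (t · u)
  inB : ∀ {x t} → Node t → Node (ƛ x t)

Elem : Term → Set
Elem t = Maybe (Node t)

-- Embedding the elements of an immediate subterm's map; the root r of the
-- subterm's map is sent to the receiving element of that subterm occurrence.
liftL : ∀ {t u} → Elem t → Elem (t · u)
liftL nothing  = just app-f
liftL (just n) = just (inL n)

liftR : ∀ {t u} → Elem u → Elem (t · u)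
liftR nothing  = just app-a
liftR (just n) = just (inR n)

liftB : ∀ {x t} → Elem t → Elem (ƛ x t)
liftB nothing  = just lam-β
liftB (just n) = just (inB n)

vNode : ∀ {t} → Node t → Node t
vNode app-f   = app-c
vNode app-c   = app-a
vNode app-a   = app-f
vNode lam-ρ   = lam-π
vNode lam-π   = lam-β
vNode lam-β   = lam-ρ
vNode (inL n) = inL (vNode n)
vNode (inR n) = inR (vNode n)
vNode (inB n) = inB (vNode n)

vTerm : ∀ t → Elem t → Elem t
vTerm t nothing  = nothing
vTerm t (just n) = just (vNode n)

freeVarAt : ∀ t → Elem t → Maybe Var
freeVarAt (var y) nothing = just y
freeVarAt (t · u) nothing = nothing
freeVarAt (t · u) (just app-f) = freeVarAt t nothing
freeVarAt (t · u) (just app-a) = freeVarAt u nothing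
freeVarAt (t · u) (just app-c) = nothing
freeVarAt (t · u) (just (inL n)) = freeVarAt t (just n)
freeVarAt (t · u) (just (inR n)) = freeVarAt u (just n)
freeVarAt (ƛ x b) nothing = nothing
freeVarAt (ƛ x b) (just lam-ρ) = nothing
freeVarAt (ƛ x b) (just lam-π) = nothing
freeVarAt (ƛ x b) (just lam-β) = dropVar x (freeVarAt b nothing)
  where
  dropVar : Var → Maybe Var → Maybe Var
  dropVar x nothing = nothing
  dropVar x (just y) with y ≟ x
  ... | yes _ = nothing
  ... | no  _ = just y
freeVarAt (ƛ x b) (just (inB n)) = dropVar x (freeVarAt b (just n))
  where
  dropVar : Var → Maybe Var → Maybe Var
  dropVar x nothing = nothing
  dropVar x (just y) with y ≟ x
  ... | yes _ = nothing
  ... | no  _ = just y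

findFree : Var → ∀ t → Maybe (Elem t)
findFree x (var y) with y ≟ x
... | yes _ = just nothing
... | no  _ = nothing
findFree x (t · u) with findFree x t
... | just m  = just (liftL m)
... | nothing with findFree x u
...   | just m  = just (liftR m)
...   | nothing = nothing
findFree x (ƛ y b) with y ≟ x
... | yes _ = nothing
... | no  _ with findFree x b
...   | just m  = just (liftB m)
...   | nothing = nothing

-- e: swaps the producing and receiving element of every subterm occurrence
-- that is not a free-variable occurrence, and fixes the receiving elements
-- of free-variable occurrences.  Defined compositionally: within the map
-- of an immediate subterm the free occurrences of the variable bound by an
-- abstraction are fixed points; the abstraction re-pairs that receiving
-- element with its parameter element π.
eTerm : ∀ t → Elem t → Elem t
eTerm (var y) nothing = nothing
eTerm (t · u) nothing = just app-c
eTerm (t · u) (just app-c) = nothing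
eTerm (t · u) (just app-f) = liftL (eTerm t nothing)
eTerm (t · u) (just (inL n)) = liftL (eTerm t (just n))
eTerm (t · u) (just app-a) = liftR (eTerm u nothing)
eTerm (t · u) (just (inR n)) = liftR (eTerm u (just n))
eTerm (ƛ x b) nothing = just lam-ρ
eTerm (ƛ x b) (just lam-ρ) = nothing
eTerm (ƛ x b) (just lam-π) with findFree x b
... | just m  = liftB m
... | nothing = just lam-π
eTerm (ƛ x b) (just lam-β) = eBody x b nothing
  where
  eBody : ∀ x b → Elem b → Elem (ƛ x b)
  eBody x b m with freeVarAt b m
  ... | nothing = liftB (eTerm b m)
  ... | just y with y ≟ x
  ...   | yes _ = just lam-π
  ...   | no  _ = liftB (eTerm b m)
eTerm (ƛ x b) (just (inB n)) = eBody x b (just n)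
  where
  eBody : ∀ x b → Elem b → Elem (ƛ x b)
  eBody x b m with freeVarAt b m
  ... | nothing = liftB (eTerm b m)
  ... | just y with y ≟ x
  ...   | yes _ = just lam-π
  ...   | no  _ = liftB (eTerm b m)

record UnderlyingMapIso (t : Term) (M : ClosedRootedTrivalentMap) : Set₁ where
  open ClosedRootedTrivalentMap M
  field
    φ      : Elem t ↔ Carrier
  open Inverse φ using (to)
  field
    comm-v : ∀ m → to (vTerm t m) ≡ v (to m)
    comm-e : ∀ m → to (eTerm t m) ≡ e (to m)
    root   : to nothing ≡ r

-- A closed proper subterm s hangs off the rest of the map by a single edge, the one joining its root to
-- its receiving element: since s binds all its variables, no other edge leaves the elements of s. So a
-- decomposable term has a bridge. Conversely, let t have no closed proper subterm and remove an edge
-- other than the root edge. By induction on t, every element is still joined either to the root or to the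
-- receiving element of a free variable; a closed t has none, hence stays connected.

module Submission where

open import Defs
open import Data.Bool using (Bool; true; false)
open import Data.Empty using (⊥-elim)
open import Data.List using ([]; _∷_; _++_; [_])
open import Data.List.Properties using (++-assoc)
open import Data.List.Membership.Propositional using (_∈_; _∉_)
open import Data.List.Membership.Propositional.Properties using (∈-++⁺ˡ; ∈-++⁺ʳ; ∈-++⁻)
open import Data.List.Relation.Unary.All using ([])
open import Data.List.Relation.Unary.AllPairs using ([]; _∷_)
open import Data.List.Relation.Unary.Any using (here)
open import Data.List.Relation.Unary.Unique.Propositional using (Unique)
open import Data.List.Relation.Unary.Unique.Propositional.Properties
  using (Unique[x∷xs]⇒x∉xs) renaming (++⁺ to Unique-++⁺)
open import Data.List.Relation.Binary.Permutation.Propositional using (_↭_; swap; refl; ↭⇒↭ₛ)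
open import Data.List.Relation.Binary.Permutation.Propositional.Properties
  using (∈-resp-↭; ++⁺ˡ; ++-comm)
open import Data.List.Relation.Binary.Permutation.Setoid.Properties using (Unique-resp-↭)
open import Data.Maybe using (just; nothing; is-just; maybe′)
open import Data.Maybe.Properties using (just-injective) renaming (≡-dec to Maybe-≡-dec)
open import Data.Nat using (ℕ; suc; _+_; _<_; _≤_; s≤s; _≟_)
open import Data.Nat.Properties using (m≤m+n; m≤n+m; <-irrefl; ≤-<-trans; ≤-refl; <⇒≤; n<1+n)
open import Data.Product using (Σ; Σ-syntax; ∃; _×_; _,_; proj₁; proj₂)
open import Data.Sum using (_⊎_; inj₁; inj₂)
open import Data.Unit using (tt)
open import Function using (_∘_)
open import Function.Bundles using (_⇔_; mk⇔; Inverse; Equivalence)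
import Function.Properties.Equivalence as ⇔
open import Relation.Nullary using (¬_; Dec; yes; no)
open import Relation.Unary using (U)
open import Relation.Binary.PropositionalEquality
  using (_≡_; _≢_; refl; sym; trans; cong; subst; subst₂; setoid; isEquivalence; module ≡-Reasoning)
open import Relation.Binary.Construct.Closure.Equivalence as EqClosure using (EqClosure)
open import Relation.Binary.Construct.Closure.Symmetric using (fwd)
open import Relation.Binary.Construct.Closure.ReflexiveTransitive using (ε; _◅_; _◅◅_)

open ≡-Reasoning

data AppView {t u} : Elem (t · u) → Set where
  outer : AppView nothing
  cont  : AppView (just app-c)
  fun   : (m : Elem t) → AppView (liftL m)
  arg   : (m : Elem u) → AppView (liftR m)

appView : ∀ {t u} (x : Elem (t · u)) → AppView x
appView nothing        = outer
appView (just app-f)   = fun nothing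
appView (just app-a)   = arg nothing
appView (just app-c)   = cont
appView (just (inL n)) = fun (just n)
appView (just (inR n)) = arg (just n)

data LamView {y b} : Elem (ƛ y b) → Set where
  outer : LamView nothing
  ρ     : LamView (just lam-ρ)
  π     : LamView (just lam-π)
  body  : (m : Elem b) → LamView (liftB m)

lamView : ∀ {y b} (x : Elem (ƛ y b)) → LamView x
lamView nothing        = outer
lamView (just lam-ρ)   = ρ
lamView (just lam-π)   = π
lamView (just lam-β)   = body nothing
lamView (just (inB n)) = body (just n)

liftL-injective : ∀ {t u} {m m′ : Elem t} → liftL {u = u} m ≡ liftL m′ → m ≡ m′
liftL-injective {m = nothing} {nothing} _    = refl
liftL-injective {m = just _}  {just _}  refl = refl
liftL-injective {m = nothing} {just _}  ()
liftL-injective {m = just _}  {nothing} ()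

liftR-injective : ∀ {t u} {m m′ : Elem u} → liftR {t = t} m ≡ liftR m′ → m ≡ m′
liftR-injective {m = nothing} {nothing} _    = refl
liftR-injective {m = just _}  {just _}  refl = refl
liftR-injective {m = nothing} {just _}  ()
liftR-injective {m = just _}  {nothing} ()

liftB-injective : ∀ {y b} {m m′ : Elem b} → liftB {x = y} m ≡ liftB m′ → m ≡ m′
liftB-injective {m = nothing} {nothing} _    = refl
liftB-injective {m = just _}  {just _}  refl = refl
liftB-injective {m = nothing} {just _}  ()
liftB-injective {m = just _}  {nothing} ()

liftL≢liftR : ∀ {t u} (m : Elem t) (m′ : Elem u) → liftL m ≢ liftR m′
liftL≢liftR nothing  nothing  ()
liftL≢liftR nothing  (just _) ()
liftL≢liftR (just _) nothing  ()
liftL≢liftR (just _) (just _) ()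

liftL≢root : ∀ {t u} (m : Elem t) → liftL {u = u} m ≢ nothing
liftL≢root nothing  ()
liftL≢root (just _) ()

liftL≢c : ∀ {t u} (m : Elem t) → liftL {u = u} m ≢ just app-c
liftL≢c nothing  ()
liftL≢c (just _) ()

liftR≢root : ∀ {t u} (m : Elem u) → liftR {t = t} m ≢ nothing
liftR≢root nothing  ()
liftR≢root (just _) ()

liftR≢c : ∀ {t u} (m : Elem u) → liftR {t = t} m ≢ just app-c
liftR≢c nothing  ()
liftR≢c (just _) ()

liftB≢root : ∀ {y b} (m : Elem b) → liftB {x = y} m ≢ nothing
liftB≢root nothing  ()
liftB≢root (just _) ()

liftB≢ρ : ∀ {y b} (m : Elem b) → liftB {x = y} m ≢ just lam-ρ
liftB≢ρ nothing  ()
liftB≢ρ (just _) ()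

liftB≢π : ∀ {y b} (m : Elem b) → liftB {x = y} m ≢ just lam-π
liftB≢π nothing  ()
liftB≢π (just _) ()

nothing≢just : ∀ {A : Set} {a : A} → nothing ≢ just a
nothing≢just ()

eTerm-liftL : ∀ {t u} (m : Elem t) → eTerm (t · u) (liftL m) ≡ liftL (eTerm t m)
eTerm-liftL nothing  = refl
eTerm-liftL (just _) = refl

eTerm-liftR : ∀ {t u} (m : Elem u) → eTerm (t · u) (liftR m) ≡ liftR (eTerm u m)
eTerm-liftR nothing  = refl
eTerm-liftR (just _) = refl

freeVarAt-liftL : ∀ {t u} (m : Elem t) → freeVarAt (t · u) (liftL m) ≡ freeVarAt t m
freeVarAt-liftL nothing  = refl
freeVarAt-liftL (just _) = refl

freeVarAt-liftR : ∀ {t u} (m : Elem u) → freeVarAt (t · u) (liftR m) ≡ freeVarAt u m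
freeVarAt-liftR nothing  = refl
freeVarAt-liftR (just _) = refl

eTerm-liftB-bound : ∀ y b m → freeVarAt b m ≡ just y → eTerm (ƛ y b) (liftB m) ≡ just lam-π
eTerm-liftB-bound y b nothing eq with freeVarAt b nothing
eTerm-liftB-bound y b nothing refl | just .y with y ≟ y
... | yes _ = refl
... | no y≢y = ⊥-elim (y≢y refl)
eTerm-liftB-bound y b (just n) eq with freeVarAt b (just n)
eTerm-liftB-bound y b (just n) refl | just .y with y ≟ y
... | yes _ = refl
... | no y≢y = ⊥-elim (y≢y refl)

eTerm-liftB-free : ∀ y b m → freeVarAt b m ≢ just y → eTerm (ƛ y b) (liftB m) ≡ liftB (eTerm b m)
eTerm-liftB-free y b nothing ¬bound with freeVarAt b nothing
... | nothing = refl
... | just w with w ≟ y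
...   | yes refl = ⊥-elim (¬bound refl)
...   | no _     = refl
eTerm-liftB-free y b (just n) ¬bound with freeVarAt b (just n)
... | nothing = refl
... | just w with w ≟ y
...   | yes refl = ⊥-elim (¬bound refl)
...   | no _     = refl

freeVarAt-liftB-nothing : ∀ y b m → freeVarAt b m ≡ nothing → freeVarAt (ƛ y b) (liftB m) ≡ nothing
freeVarAt-liftB-nothing y b nothing  eq rewrite eq = refl
freeVarAt-liftB-nothing y b (just n) eq rewrite eq = refl

freeVarAt-liftB : ∀ y b m {w} → freeVarAt b m ≡ just w → w ≢ y → freeVarAt (ƛ y b) (liftB m) ≡ just w
freeVarAt-liftB y b nothing {w} eq w≢y rewrite eq with w ≟ y
... | yes w≡y = ⊥-elim (w≢y w≡y)
... | no _    = refl
freeVarAt-liftB y b (just n) {w} eq w≢y rewrite eq with w ≟ y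
... | yes w≡y = ⊥-elim (w≢y w≡y)
... | no _    = refl

freeVarAt-liftB⁻ : ∀ y b m {w} → freeVarAt (ƛ y b) (liftB m) ≡ just w → freeVarAt b m ≡ just w × w ≢ y
freeVarAt-liftB⁻ y b nothing eq with freeVarAt b nothing
... | nothing = ⊥-elim (nothing≢just eq)
... | just z with z ≟ y
...   | yes _ = ⊥-elim (nothing≢just eq)
...   | no z≢y with eq
...     | refl = refl , z≢y
freeVarAt-liftB⁻ y b (just n) eq with freeVarAt b (just n)
... | nothing = ⊥-elim (nothing≢just eq)
... | just z with z ≟ y
...   | yes _ = ⊥-elim (nothing≢just eq)
...   | no z≢y with eq
...     | refl = refl , z≢y

freeVarAt? : ∀ t m y → Dec (freeVarAt t m ≡ just y)
freeVarAt? t m y = Maybe-≡-dec _≟_ (freeVarAt t m) (just y)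

eTerm-fixes-freeVar : ∀ t m {w} → freeVarAt t m ≡ just w → eTerm t m ≡ m
eTerm-fixes-freeVar (var _) nothing _ = refl
eTerm-fixes-freeVar (t · u) x eq with appView x
... | outer = ⊥-elim (nothing≢just eq)
... | cont  = ⊥-elim (nothing≢just eq)
... | fun m = trans (eTerm-liftL m)
                (cong liftL (eTerm-fixes-freeVar t m (trans (sym (freeVarAt-liftL m)) eq)))
... | arg m = trans (eTerm-liftR m)
                (cong liftR (eTerm-fixes-freeVar u m (trans (sym (freeVarAt-liftR m)) eq)))
eTerm-fixes-freeVar (ƛ y b) x eq with lamView x
... | outer = ⊥-elim (nothing≢just eq)
... | ρ     = ⊥-elim (nothing≢just eq)
... | π     = ⊥-elim (nothing≢just eq)
... | body m with freeVarAt-liftB⁻ y b m eq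
...   | fm , w≢y = trans (eTerm-liftB-free y b m (λ fm′ → w≢y (just-injective (trans (sym fm) fm′))))
                         (cong liftB (eTerm-fixes-freeVar b m fm))

eTerm-rootPartner : ∀ t → eTerm t (eTerm t nothing) ≡ nothing
eTerm-rootPartner (var _) = refl
eTerm-rootPartner (_ · _) = refl
eTerm-rootPartner (ƛ _ _) = refl

findFree-sound : ∀ y b {m} → findFree y b ≡ just m → freeVarAt b m ≡ just y
findFree-sound y (var z) eq with z ≟ y
findFree-sound y (var z) refl | yes refl = refl
findFree-sound y (var z) ()   | no _
findFree-sound y (t · u) eq with findFree y t in ft
findFree-sound y (t · u) refl | just m = trans (freeVarAt-liftL m) (findFree-sound y t ft)
... | nothing with findFree y u in fu
findFree-sound y (t · u) refl | nothing | just m = trans (freeVarAt-liftR m) (findFree-sound y u fu)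
findFree-sound y (t · u) ()   | nothing | nothing
findFree-sound y (ƛ z b) eq with z ≟ y
findFree-sound y (ƛ z b) () | yes _
... | no z≢y with findFree y b in fb
findFree-sound y (ƛ z b) refl | no z≢y | just m = freeVarAt-liftB z b m (findFree-sound y b fb) (λ y≡z → z≢y (sym y≡z))
findFree-sound y (ƛ z b) ()   | no z≢y | nothing

findFree-complete : ∀ y b m → freeVarAt b m ≡ just y → Σ (Elem b) λ m′ → findFree y b ≡ just m′
findFree-complete y (var z) nothing eq with z ≟ y
... | yes _   = nothing , refl
... | no z≢y = ⊥-elim (z≢y (just-injective eq))
findFree-complete y (t · u) x eq with findFree y t in ft
... | just m = liftL m , refl
... | nothing with findFree y u in fu
...   | just m = liftR m , refl
...   | nothing with appView x
...     | outer = ⊥-elim (nothing≢just eq)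
...     | cont  = ⊥-elim (nothing≢just eq)
...     | fun m = ⊥-elim (nothing≢just (trans (sym ft)
                    (proj₂ (findFree-complete y t m (trans (sym (freeVarAt-liftL m)) eq)))))
...     | arg m = ⊥-elim (nothing≢just (trans (sym fu)
                    (proj₂ (findFree-complete y u m (trans (sym (freeVarAt-liftR m)) eq)))))
findFree-complete y (ƛ z b) x eq with lamView x
... | outer = ⊥-elim (nothing≢just eq)
... | ρ     = ⊥-elim (nothing≢just eq)
... | π     = ⊥-elim (nothing≢just eq)
... | body m with freeVarAt-liftB⁻ z b m eq
...   | fm , y≢z with z ≟ y
...     | yes z≡y = ⊥-elim (y≢z (sym z≡y))
...     | no _ with findFree y b in fb
...       | just m′  = liftB m′ , refl
...       | nothing = ⊥-elim (nothing≢just (trans (sym fb) (proj₂ (findFree-complete y b m fm))))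

data ParamView (y : Var) (b : Term) : Set where
  unused : (∀ m → freeVarAt b m ≢ just y) → eTerm (ƛ y b) (just lam-π) ≡ just lam-π → ParamView y b
  used   : (m : Elem b) → freeVarAt b m ≡ just y → eTerm (ƛ y b) (just lam-π) ≡ liftB m → ParamView y b

eTerm-π : ∀ y b → eTerm (ƛ y b) (just lam-π) ≡ maybe′ liftB (just lam-π) (findFree y b)
eTerm-π y b with findFree y b
... | just _  = refl
... | nothing = refl

paramView : ∀ y b → ParamView y b
paramView y b with findFree y b in fb
... | just m  = used m (findFree-sound y b fb) (trans (eTerm-π y b) (cong (maybe′ liftB _) fb))
... | nothing = unused (λ m fm → nothing≢just (trans (sym fb) (proj₂ (findFree-complete y b m fm))))
                       (trans (eTerm-π y b) (cong (maybe′ liftB _) fb))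

exchange-↭ : ∀ (Γ : Context) {x y Δ} → Γ ++ y ∷ x ∷ Δ ↭ Γ ++ x ∷ y ∷ Δ
exchange-↭ Γ = ++⁺ˡ Γ (swap _ _ refl)

freeVar∈context : ∀ {Γ t} → Γ ⊢ t → ∀ m {w} → freeVarAt t m ≡ just w → w ∈ Γ
freeVar∈context ax nothing eq = here (sym (just-injective eq))
freeVar∈context (app {Γ = Γ₁} d₁ d₂ _) x eq with appView x
... | outer = ⊥-elim (nothing≢just eq)
... | cont  = ⊥-elim (nothing≢just eq)
... | fun m = ∈-++⁺ˡ (freeVar∈context d₁ m (trans (sym (freeVarAt-liftL m)) eq))
... | arg m = ∈-++⁺ʳ Γ₁ (freeVar∈context d₂ m (trans (sym (freeVarAt-liftR m)) eq))
freeVar∈context (lam {Γ = Γ} {x = y} {t = b} d) x eq with lamView x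
... | outer = ⊥-elim (nothing≢just eq)
... | ρ     = ⊥-elim (nothing≢just eq)
... | π     = ⊥-elim (nothing≢just eq)
... | body m with freeVarAt-liftB⁻ y b m eq
...   | fm , w≢y with ∈-++⁻ Γ (freeVar∈context d m fm)
...     | inj₁ w∈Γ        = w∈Γ
...     | inj₂ (here w≡y) = ⊥-elim (w≢y w≡y)
freeVar∈context (exch {Γ = Γ} d) m eq = ∈-resp-↭ (exchange-↭ Γ) (freeVar∈context d m eq)

closed⇒noFreeVar : ∀ {t} → [] ⊢ t → ∀ m → freeVarAt t m ≡ nothing
closed⇒noFreeVar {t} d m with freeVarAt t m in eq
... | nothing = refl
... | just _ with freeVar∈context d m eq
...   | ()

snoc-unique : ∀ (Γ : Context) {x} → Unique (Γ ++ [ x ]) → x ∉ Γ × Unique Γ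
snoc-unique Γ {x} u with Unique-resp-↭ (setoid _) (↭⇒↭ₛ (++-comm Γ [ x ])) u
... | x∷Γ@(_ ∷ uΓ) = Unique[x∷xs]⇒x∉xs x∷Γ , uΓ

context-unique : ∀ {Γ t} → Γ ⊢ t → Unique Γ
context-unique ax              = [] ∷ []
context-unique (app d₁ d₂ Γ#Δ) = Unique-++⁺ (context-unique d₁) (context-unique d₂) Γ#Δ
context-unique (lam {Γ = Γ} d) = proj₂ (snoc-unique Γ (context-unique d))
context-unique (exch {Γ = Γ} d) = Unique-resp-↭ (setoid _) (↭⇒↭ₛ (exchange-↭ Γ)) (context-unique d)

freeVar-receiver-unique : ∀ {Γ t} → Γ ⊢ t → ∀ m m′ {w} →
  freeVarAt t m ≡ just w → freeVarAt t m′ ≡ just w → m ≡ m′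
freeVar-receiver-unique ax nothing nothing _ _ = refl
freeVar-receiver-unique (exch d) m m′ fm fm′ = freeVar-receiver-unique d m m′ fm fm′
freeVar-receiver-unique (app d₁ d₂ Γ#Δ) x x′ fx fx′ with appView x | appView x′
... | outer | _     = ⊥-elim (nothing≢just fx)
... | cont  | _     = ⊥-elim (nothing≢just fx)
... | _     | outer = ⊥-elim (nothing≢just fx′)
... | _     | cont  = ⊥-elim (nothing≢just fx′)
... | fun m | fun m′ = cong liftL (freeVar-receiver-unique d₁ m m′
                         (trans (sym (freeVarAt-liftL m)) fx) (trans (sym (freeVarAt-liftL m′)) fx′))
... | arg m | arg m′ = cong liftR (freeVar-receiver-unique d₂ m m′
                         (trans (sym (freeVarAt-liftR m)) fx) (trans (sym (freeVarAt-liftR m′)) fx′))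
... | fun m | arg m′ = ⊥-elim (Γ#Δ (freeVar∈context d₁ m (trans (sym (freeVarAt-liftL m)) fx) ,
                                     freeVar∈context d₂ m′ (trans (sym (freeVarAt-liftR m′)) fx′)))
... | arg m | fun m′ = ⊥-elim (Γ#Δ (freeVar∈context d₁ m′ (trans (sym (freeVarAt-liftL m′)) fx′) ,
                                     freeVar∈context d₂ m (trans (sym (freeVarAt-liftR m)) fx)))
freeVar-receiver-unique (lam {x = y} {t = b} d) x x′ fx fx′ with lamView x | lamView x′
... | outer  | _      = ⊥-elim (nothing≢just fx)
... | ρ      | _      = ⊥-elim (nothing≢just fx)
... | π      | _      = ⊥-elim (nothing≢just fx)
... | body _ | outer  = ⊥-elim (nothing≢just fx′)
... | body _ | ρ      = ⊥-elim (nothing≢just fx′)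
... | body _ | π      = ⊥-elim (nothing≢just fx′)
... | body m | body m′ = cong liftB (freeVar-receiver-unique d m m′
                           (proj₁ (freeVarAt-liftB⁻ y b m fx)) (proj₁ (freeVarAt-liftB⁻ y b m′ fx′)))

eTerm-involutive : ∀ {Γ t} → Γ ⊢ t → ∀ m → eTerm t (eTerm t m) ≡ m
eTerm-involutive ax nothing = refl
eTerm-involutive (exch d) m = eTerm-involutive d m
eTerm-involutive (app {t = t} {u = u} d₁ d₂ _) x with appView x
... | outer = refl
... | cont  = refl
... | fun m = trans (cong (eTerm (t · u)) (eTerm-liftL m))
                (trans (eTerm-liftL (eTerm t m)) (cong liftL (eTerm-involutive d₁ m)))
... | arg m = trans (cong (eTerm (t · u)) (eTerm-liftR m))
                (trans (eTerm-liftR (eTerm u m)) (cong liftR (eTerm-involutive d₂ m)))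
eTerm-involutive (lam {x = y} {t = b} d) x with lamView x
... | outer = refl
... | ρ     = refl
... | π with paramView y b
...   | unused _ eπ    = trans (cong (eTerm (ƛ y b)) eπ) eπ
...   | used m fm eπ = trans (cong (eTerm (ƛ y b)) eπ) (eTerm-liftB-bound y b m fm)
eTerm-involutive (lam {x = y} {t = b} d) x | body m with freeVarAt? b m y
... | yes fm with paramView y b
...   | unused unbound _ = ⊥-elim (unbound m fm)
...   | used m′ fm′ eπ = trans (cong (eTerm (ƛ y b)) (eTerm-liftB-bound y b m fm))
                          (trans eπ (cong liftB (freeVar-receiver-unique d m′ m fm′ fm)))
eTerm-involutive (lam {x = y} {t = b} d) x | body m | no ¬fm with freeVarAt? b (eTerm b m) y
... | yes fem = ⊥-elim (¬fm (subst (λ k → freeVarAt b k ≡ just y) em≡m fem))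
  where
  em≡m : eTerm b m ≡ m
  em≡m = trans (sym (eTerm-fixes-freeVar b (eTerm b m) fem)) (eTerm-involutive d m)
... | no ¬fem = trans (cong (eTerm (ƛ y b)) (eTerm-liftB-free y b m ¬fm))
                  (trans (eTerm-liftB-free y b (eTerm b m) ¬fem) (cong liftB (eTerm-involutive d m)))

Step : ∀ t → (Elem t → Set) → Elem t → Elem t → Set
Step t Allowed x y = y ≡ vTerm t x ⊎ (y ≡ eTerm t x × Allowed x)

Walk : ∀ t → (Elem t → Set) → Elem t → Elem t → Set
Walk t Allowed = EqClosure (Step t Allowed)

OffEdge : ∀ t → Elem t → Elem t → Set
OffEdge t E x = x ≢ E × x ≢ eTerm t E

OffRootEdge : ∀ t → Elem t → Set
OffRootEdge t = OffEdge t nothing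

v-step : ∀ {t A} x → Walk t A x (vTerm t x)
v-step x = fwd (inj₁ refl) ◅ ε

e-step : ∀ {t A} x → A x → Walk t A x (eTerm t x)
e-step x ok = fwd (inj₂ (refl , ok)) ◅ ε

walk-sym : ∀ {t A x y} → Walk t A x y → Walk t A y x
walk-sym {t} {A} = EqClosure.symmetric (Step t A)

infixr 5 _▸_
_▸_ : ∀ {t A x y z} → Walk t A x y → Walk t A y z → Walk t A x z
_▸_ = _◅◅_

≡⇒walk : ∀ {t A x y} → x ≡ y → Walk t A x y
≡⇒walk refl = ε

walk-mono : ∀ {t A B} → (∀ x → A x → B x) → ∀ {x y} → Walk t A x y → Walk t B x y
walk-mono {t} {A} {B} A⊆B = EqClosure.map step
  where
  step : ∀ {x y} → Step t A x y → Step t B x y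
  step (inj₁ eq)        = inj₁ eq
  step (inj₂ (eq , ok)) = inj₂ (eq , A⊆B _ ok)

walk-map : ∀ {s t A B} (f : Elem s → Elem t) →
  (∀ {x y} → Step s A x y → Walk t B (f x) (f y)) → ∀ {x y} → Walk s A x y → Walk t B (f x) (f y)
walk-map {t = t} {B = B} = EqClosure.gfold (EqClosure.isEquivalence (Step t B))

liftL-walk : ∀ {t u A B} → (∀ m → A m → B (liftL m)) →
  ∀ {x y} → Walk t A x y → Walk (t · u) B (liftL x) (liftL y)
liftL-walk {t} {u} {A} {B} allowed = walk-map liftL step
  where
  step : ∀ {x y} → Step t A x y → Walk (t · u) B (liftL x) (liftL y)
  step {nothing} (inj₁ refl)        = ε
  step {just n}  (inj₁ refl)        = v-step (just (inL n))
  step {x}       (inj₂ (refl , ok)) = e-step (liftL x) (allowed x ok) ▸ ≡⇒walk (eTerm-liftL x)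

liftR-walk : ∀ {t u A B} → (∀ m → A m → B (liftR m)) →
  ∀ {x y} → Walk u A x y → Walk (t · u) B (liftR x) (liftR y)
liftR-walk {t} {u} {A} {B} allowed = walk-map liftR step
  where
  step : ∀ {x y} → Step u A x y → Walk (t · u) B (liftR x) (liftR y)
  step {nothing} (inj₁ refl)        = ε
  step {just n}  (inj₁ refl)        = v-step (just (inR n))
  step {x}       (inj₂ (refl , ok)) = e-step (liftR x) (allowed x ok) ▸ ≡⇒walk (eTerm-liftR x)

-- Edges at occurrences of the bound variable are rerouted through π and so need not be allowed.
liftB-walk : ∀ {y b A B} → (∀ m → A m → freeVarAt b m ≢ just y → B (liftB m)) →
  ∀ {x x′} → Walk b A x x′ → Walk (ƛ y b) B (liftB x) (liftB x′)
liftB-walk {y} {b} {A} {B} allowed = walk-map liftB step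
  where
  step : ∀ {x x′} → Step b A x x′ → Walk (ƛ y b) B (liftB x) (liftB x′)
  step {nothing} (inj₁ refl) = ε
  step {just n}  (inj₁ refl) = v-step (just (inB n))
  step {x} (inj₂ (refl , ok)) with freeVarAt? b x y
  ... | yes bound = ≡⇒walk (cong liftB (sym (eTerm-fixes-freeVar b x bound)))
  ... | no free   = e-step (liftB x) (allowed x ok free) ▸ ≡⇒walk (eTerm-liftB-free y b x free)

node↝rootPartner : ∀ t n → Walk t (OffRootEdge t) (just n) (eTerm t nothing)
node↝rootPartner (t · u) = walk
  where
  f↝c : Walk (t · u) (OffRootEdge (t · u)) (just app-f) (just app-c)
  f↝c = v-step (just app-f)
  a↝c : Walk (t · u) (OffRootEdge (t · u)) (just app-a) (just app-c)
  a↝c = walk-sym (v-step (just app-c))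
  walk : ∀ n → Walk (t · u) (OffRootEdge (t · u)) (just n) (just app-c)
  walk app-f   = f↝c
  walk app-a   = a↝c
  walk app-c   = ε
  walk (inL n) = liftL-walk (λ m _ → liftL≢root m , liftL≢c m) (node↝rootPartner t n)
               ▸ walk-sym (e-step (just app-f) ((λ ()) , (λ ()))) ▸ f↝c
  walk (inR n) = liftR-walk (λ m _ → liftR≢root m , liftR≢c m) (node↝rootPartner u n)
               ▸ walk-sym (e-step (just app-a) ((λ ()) , (λ ()))) ▸ a↝c
node↝rootPartner (ƛ y b) = walk
  where
  β↝ρ : Walk (ƛ y b) (OffRootEdge (ƛ y b)) (just lam-β) (just lam-ρ)
  β↝ρ = v-step (just lam-β)
  bodyPartner↝β : Walk (ƛ y b) (OffRootEdge (ƛ y b)) (liftB (eTerm b nothing)) (just lam-β)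
  bodyPartner↝β with freeVarAt? b nothing y
  ... | yes bound = ≡⇒walk (cong liftB (eTerm-fixes-freeVar b nothing bound))
  ... | no free   = ≡⇒walk (sym (eTerm-liftB-free y b nothing free))
                  ▸ walk-sym (e-step (just lam-β) ((λ ()) , (λ ())))
  walk : ∀ n → Walk (ƛ y b) (OffRootEdge (ƛ y b)) (just n) (just lam-ρ)
  walk lam-ρ   = ε
  walk lam-π   = walk-sym (v-step (just lam-ρ))
  walk lam-β   = β↝ρ
  walk (inB n) = liftB-walk (λ m _ _ → liftB≢root m , liftB≢ρ m) (node↝rootPartner b n)
               ▸ bodyPartner↝β ▸ β↝ρ

freeVar↝rootPartner : ∀ t z {w} → freeVarAt t z ≡ just w → Walk t (OffRootEdge t) z (eTerm t nothing)
freeVar↝rootPartner (var _) nothing  _  = ε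
freeVar↝rootPartner (_ · _) nothing  ()
freeVar↝rootPartner (ƛ _ _) nothing  ()
freeVar↝rootPartner t       (just n) _  = node↝rootPartner t n

↝root : ∀ t x → Walk t U x nothing
↝root t nothing  = ε
↝root t (just n) = walk-mono _ (node↝rootPartner t n) ▸ walk-sym (e-step nothing tt)

context-var-occurs : ∀ {Γ t} → Γ ⊢ t → ∀ {w} → w ∈ Γ → Σ (Elem t) λ z → freeVarAt t z ≡ just w
context-var-occurs ax (here refl) = nothing , refl
context-var-occurs (exch {Γ = Γ} d) w∈ = context-var-occurs d (∈-resp-↭ (exchange-↭ Γ) w∈)
context-var-occurs (app {Γ = Γ₁} d₁ d₂ _) w∈ with ∈-++⁻ Γ₁ w∈
... | inj₁ w∈Γ₁ with context-var-occurs d₁ w∈Γ₁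
...   | z , fz = liftL z , trans (freeVarAt-liftL z) fz
context-var-occurs (app {Γ = Γ₁} d₁ d₂ _) w∈ | inj₂ w∈Γ₂ with context-var-occurs d₂ w∈Γ₂
...   | z , fz = liftR z , trans (freeVarAt-liftR z) fz
context-var-occurs (lam {Γ = Γ} {x = y} {t = b} d) w∈ with context-var-occurs d (∈-++⁺ˡ w∈)
... | z , fz = liftB z , freeVarAt-liftB y b z fz (λ { refl → proj₁ (snoc-unique Γ (context-unique d)) w∈ })

-- A closed proper subterm gives a bridge

false≢true : false ≢ true
false≢true ()

ConnectedOff : ∀ t → Elem t → Set
ConnectedOff t E = ∀ x y → Walk t (OffEdge t E) x y

IsBridgeOf : ∀ t → Elem t → Set
IsBridgeOf t E = OffRootEdge t E × ¬ ConnectedOff t E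

TermBridgeless : Term → Set
TermBridgeless t = ∀ E → ¬ IsBridgeOf t E

-- A colouring witnessing that removing `edge` disconnects the map. Receivers of free variables are
-- kept outside so that the colouring survives abstraction over them.
record Separation (t : Term) : Set where
  field
    edge              : Elem t
    inside            : Elem t → Bool
    witness           : Elem t
    witness-inside    : inside witness ≡ true
    root-outside      : inside nothing ≡ false
    inside-v          : ∀ x → inside (vTerm t x) ≡ inside x
    inside-e          : ∀ x → OffEdge t edge x → inside (eTerm t x) ≡ inside x
    edge-notFreeVar   : freeVarAt t edge ≡ nothing
    inside-notFreeVar : ∀ x → inside x ≡ true → freeVarAt t x ≡ nothing

  inside-walk : ∀ {x y} → Walk t (OffEdge t edge) x y → inside x ≡ inside y
  inside-walk = EqClosure.gfold isEquivalence inside step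
    where
    step : ∀ {x y} → Step t (OffEdge t edge) x y → inside x ≡ inside y
    step {x} (inj₁ refl)        = sym (inside-v x)
    step {x} (inj₂ (refl , off)) = sym (inside-e x off)

  freeVar-outside : ∀ m {w} → freeVarAt t m ≡ just w → inside m ≡ false
  freeVar-outside m fm with inside m in eq
  ... | false = refl
  ... | true  = ⊥-elim (nothing≢just (trans (sym (inside-notFreeVar m eq)) fm))

  disconnects : ¬ ConnectedOff t edge
  disconnects connected with trans (sym root-outside)
                              (trans (inside-walk (connected nothing witness)) witness-inside)
  ... | ()

open Separation

closed-node : ∀ {t} → [] ⊢ t → Node t
closed-node {var _} d with closed⇒noFreeVar d nothing
... | ()
closed-node {_ · _} _ = app-c
closed-node {ƛ _ _} _ = lam-ρ

closed-separation : ∀ {t} → [] ⊢ t → Separation t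
closed-separation {t} d = record
  { edge = nothing ; inside = is-just ; witness = just (closed-node d) ; witness-inside = refl
  ; root-outside = refl ; inside-v = v-just ; inside-e = e-just
  ; edge-notFreeVar = closed⇒noFreeVar d nothing
  ; inside-notFreeVar = λ x _ → closed⇒noFreeVar d x }
  where
  v-just : ∀ x → is-just (vTerm t x) ≡ is-just x
  v-just nothing  = refl
  v-just (just _) = refl
  e-just : ∀ x → OffEdge t nothing x → is-just (eTerm t x) ≡ is-just x
  e-just nothing (x≢r , _) = ⊥-elim (x≢r refl)
  e-just (just n) (_ , x≢e) with eTerm t (just n) in eq
  ... | just _  = refl
  ... | nothing = ⊥-elim (x≢e (trans (sym (eTerm-involutive d (just n))) (cong (eTerm t) eq)))

liftL-separation : ∀ {t u} → Separation t → Separation (t · u)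
liftL-separation {t} {u} S = record
  { edge = liftL (edge S) ; inside = inside′ ; witness = liftL (witness S)
  ; witness-inside = trans (inside′-liftL (witness S)) (witness-inside S)
  ; root-outside = refl ; inside-v = v-inside′ ; inside-e = e-inside′
  ; edge-notFreeVar = trans (freeVarAt-liftL (edge S)) (edge-notFreeVar S)
  ; inside-notFreeVar = notFreeVar }
  where
  inside′ : Elem (t · u) → Bool
  inside′ (just app-f)   = inside S nothing
  inside′ (just (inL n)) = inside S (just n)
  inside′ _              = false
  inside′-liftL : ∀ m → inside′ (liftL m) ≡ inside S m
  inside′-liftL nothing  = refl
  inside′-liftL (just _) = refl
  inside′-liftR : ∀ m → inside′ (liftR m) ≡ false
  inside′-liftR nothing  = refl
  inside′-liftR (just _) = refl
  v-inside′ : ∀ x → inside′ (vTerm (t · u) x) ≡ inside′ x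
  v-inside′ nothing        = refl
  v-inside′ (just app-f)   = sym (root-outside S)
  v-inside′ (just app-a)   = root-outside S
  v-inside′ (just app-c)   = refl
  v-inside′ (just (inL n)) = inside-v S (just n)
  v-inside′ (just (inR _)) = refl
  e-inside′ : ∀ x → OffEdge (t · u) (liftL (edge S)) x → inside′ (eTerm (t · u) x) ≡ inside′ x
  e-inside′ x (x≢E , x≢eE) with appView x
  ... | outer = refl
  ... | cont  = refl
  ... | fun m = begin
    inside′ (eTerm (t · u) (liftL m)) ≡⟨ cong inside′ (eTerm-liftL m) ⟩
    inside′ (liftL (eTerm t m))       ≡⟨ inside′-liftL (eTerm t m) ⟩
    inside S (eTerm t m)              ≡⟨ inside-e S m (x≢E ∘ cong liftL , x≢eE ∘ liftL-edge) ⟩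
    inside S m                        ≡⟨ inside′-liftL m ⟨
    inside′ (liftL m)                 ∎
    where
    liftL-edge : m ≡ eTerm t (edge S) → liftL m ≡ eTerm (t · u) (liftL (edge S))
    liftL-edge m≡ = trans (cong liftL m≡) (sym (eTerm-liftL (edge S)))
  ... | arg m = trans (cong inside′ (eTerm-liftR m))
                  (trans (inside′-liftR (eTerm u m)) (sym (inside′-liftR m)))
  notFreeVar : ∀ x → inside′ x ≡ true → freeVarAt (t · u) x ≡ nothing
  notFreeVar x in-x with appView x
  ... | outer = ⊥-elim (false≢true in-x)
  ... | cont  = ⊥-elim (false≢true in-x)
  ... | fun m = trans (freeVarAt-liftL m) (inside-notFreeVar S m (trans (sym (inside′-liftL m)) in-x))
  ... | arg m = ⊥-elim (false≢true (trans (sym (inside′-liftR m)) in-x))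

liftR-separation : ∀ {t u} → Separation u → Separation (t · u)
liftR-separation {t} {u} S = record
  { edge = liftR (edge S) ; inside = inside′ ; witness = liftR (witness S)
  ; witness-inside = trans (inside′-liftR (witness S)) (witness-inside S)
  ; root-outside = refl ; inside-v = v-inside′ ; inside-e = e-inside′
  ; edge-notFreeVar = trans (freeVarAt-liftR (edge S)) (edge-notFreeVar S)
  ; inside-notFreeVar = notFreeVar }
  where
  inside′ : Elem (t · u) → Bool
  inside′ (just app-a)   = inside S nothing
  inside′ (just (inR n)) = inside S (just n)
  inside′ _              = false
  inside′-liftR : ∀ m → inside′ (liftR m) ≡ inside S m
  inside′-liftR nothing  = refl
  inside′-liftR (just _) = refl
  inside′-liftL : ∀ m → inside′ (liftL m) ≡ false
  inside′-liftL nothing  = refl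
  inside′-liftL (just _) = refl
  v-inside′ : ∀ x → inside′ (vTerm (t · u) x) ≡ inside′ x
  v-inside′ nothing        = refl
  v-inside′ (just app-f)   = refl
  v-inside′ (just app-a)   = sym (root-outside S)
  v-inside′ (just app-c)   = root-outside S
  v-inside′ (just (inL _)) = refl
  v-inside′ (just (inR n)) = inside-v S (just n)
  e-inside′ : ∀ x → OffEdge (t · u) (liftR (edge S)) x → inside′ (eTerm (t · u) x) ≡ inside′ x
  e-inside′ x (x≢E , x≢eE) with appView x
  ... | outer = refl
  ... | cont  = refl
  ... | fun m = trans (cong inside′ (eTerm-liftL m))
                  (trans (inside′-liftL (eTerm t m)) (sym (inside′-liftL m)))
  ... | arg m = begin
    inside′ (eTerm (t · u) (liftR m)) ≡⟨ cong inside′ (eTerm-liftR m) ⟩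
    inside′ (liftR (eTerm u m))       ≡⟨ inside′-liftR (eTerm u m) ⟩
    inside S (eTerm u m)              ≡⟨ inside-e S m (x≢E ∘ cong liftR , x≢eE ∘ liftR-edge) ⟩
    inside S m                        ≡⟨ inside′-liftR m ⟨
    inside′ (liftR m)                 ∎
    where
    liftR-edge : m ≡ eTerm u (edge S) → liftR m ≡ eTerm (t · u) (liftR (edge S))
    liftR-edge m≡ = trans (cong liftR m≡) (sym (eTerm-liftR (edge S)))
  notFreeVar : ∀ x → inside′ x ≡ true → freeVarAt (t · u) x ≡ nothing
  notFreeVar x in-x with appView x
  ... | outer = ⊥-elim (false≢true in-x)
  ... | cont  = ⊥-elim (false≢true in-x)
  ... | fun m = ⊥-elim (false≢true (trans (sym (inside′-liftL m)) in-x))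
  ... | arg m = trans (freeVarAt-liftR m) (inside-notFreeVar S m (trans (sym (inside′-liftR m)) in-x))

-- Occurrences of the bound variable are outside, so rerouting their edges through π is harmless.
liftB-separation : ∀ {y b} → Separation b → Separation (ƛ y b)
liftB-separation {y} {b} S = record
  { edge = liftB (edge S) ; inside = inside′ ; witness = liftB (witness S)
  ; witness-inside = trans (inside′-liftB (witness S)) (witness-inside S)
  ; root-outside = refl ; inside-v = v-inside′ ; inside-e = e-inside′
  ; edge-notFreeVar = freeVarAt-liftB-nothing y b (edge S) (edge-notFreeVar S)
  ; inside-notFreeVar = notFreeVar }
  where
  inside′ : Elem (ƛ y b) → Bool
  inside′ (just lam-β)   = inside S nothing
  inside′ (just (inB n)) = inside S (just n)
  inside′ _              = false
  inside′-liftB : ∀ m → inside′ (liftB m) ≡ inside S m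
  inside′-liftB nothing  = refl
  inside′-liftB (just _) = refl
  e-edge : eTerm (ƛ y b) (liftB (edge S)) ≡ liftB (eTerm b (edge S))
  e-edge = eTerm-liftB-free y b (edge S) (λ bound → nothing≢just (trans (sym (edge-notFreeVar S)) bound))
  bound-outside : ∀ m → freeVarAt b m ≡ just y → inside′ (liftB m) ≡ false
  bound-outside m fm = trans (inside′-liftB m) (freeVar-outside S m fm)
  v-inside′ : ∀ x → inside′ (vTerm (ƛ y b) x) ≡ inside′ x
  v-inside′ nothing        = refl
  v-inside′ (just lam-ρ)   = refl
  v-inside′ (just lam-π)   = root-outside S
  v-inside′ (just lam-β)   = sym (root-outside S)
  v-inside′ (just (inB n)) = inside-v S (just n)
  e-inside′ : ∀ x → OffEdge (ƛ y b) (liftB (edge S)) x → inside′ (eTerm (ƛ y b) x) ≡ inside′ x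
  e-inside′ x (x≢E , x≢eE) with lamView x
  ... | outer = refl
  ... | ρ     = refl
  ... | π with paramView y b
  ...   | unused _ eπ    = cong inside′ eπ
  ...   | used m fm eπ   = trans (cong inside′ eπ) (bound-outside m fm)
  e-inside′ x (x≢E , x≢eE) | body m with freeVarAt? b m y
  ... | yes fm = trans (cong inside′ (eTerm-liftB-bound y b m fm)) (sym (bound-outside m fm))
  ... | no ¬fm = begin
    inside′ (eTerm (ƛ y b) (liftB m)) ≡⟨ cong inside′ (eTerm-liftB-free y b m ¬fm) ⟩
    inside′ (liftB (eTerm b m))       ≡⟨ inside′-liftB (eTerm b m) ⟩
    inside S (eTerm b m)              ≡⟨ inside-e S m (x≢E ∘ cong liftB , x≢eE ∘ liftB-edge) ⟩
    inside S m                        ≡⟨ inside′-liftB m ⟨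
    inside′ (liftB m)                 ∎
    where
    liftB-edge : m ≡ eTerm b (edge S) → liftB m ≡ eTerm (ƛ y b) (liftB (edge S))
    liftB-edge m≡ = trans (cong liftB m≡) (sym e-edge)
  notFreeVar : ∀ x → inside′ x ≡ true → freeVarAt (ƛ y b) x ≡ nothing
  notFreeVar x in-x with lamView x
  ... | outer  = ⊥-elim (false≢true in-x)
  ... | ρ      = ⊥-elim (false≢true in-x)
  ... | π      = ⊥-elim (false≢true in-x)
  ... | body m = freeVarAt-liftB-nothing y b m (inside-notFreeVar S m (trans (sym (inside′-liftB m)) in-x))

closedSubterm-separation : ∀ {Γ t s} → Γ ⊢ t → Subterm (Γ , t) ([] , s) → Separation t
closedSubterm-separation d self              = closed-separation d
closedSubterm-separation _ (appL d₁ _ sub)   = liftL-separation (closedSubterm-separation d₁ sub)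
closedSubterm-separation _ (appR _ d₂ sub)   = liftR-separation (closedSubterm-separation d₂ sub)
closedSubterm-separation _ (lamB d sub)      = liftB-separation (closedSubterm-separation d sub)

closedProperSubterm-separation : ∀ {Γ t s} → Γ ⊢ t → ProperSubterm (Γ , t) ([] , s) →
  Σ[ S ∈ Separation t ] OffRootEdge t (edge S)
closedProperSubterm-separation _ (self , s≢t) = ⊥-elim (s≢t refl)
closedProperSubterm-separation _ (appL d₁ _ sub , _) =
  let S = closedSubterm-separation d₁ sub in liftL-separation S , liftL≢root (edge S) , liftL≢c (edge S)
closedProperSubterm-separation _ (appR _ d₂ sub , _) =
  let S = closedSubterm-separation d₂ sub in liftR-separation S , liftR≢root (edge S) , liftR≢c (edge S)
closedProperSubterm-separation _ (lamB d sub , _) =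
  let S = closedSubterm-separation d sub in liftB-separation S , liftB≢root (edge S) , liftB≢ρ (edge S)

bridgeless⇒indecomposable : ∀ {Γ t} → Γ ⊢ t → TermBridgeless t → Indecomposable (Γ , t)
bridgeless⇒indecomposable d bridgeless (_ , proper) with closedProperSubterm-separation d proper
... | S , off = bridgeless (edge S) (off , disconnects S)

-- Without closed proper subterms there is no bridge

data ContainsClosed : Term → Set where
  closedFun : ∀ {t u} → [] ⊢ t → ContainsClosed (t · u)
  closedArg : ∀ {t u} → [] ⊢ u → ContainsClosed (t · u)
  inFun     : ∀ {t u} → ContainsClosed t → ContainsClosed (t · u)
  inArg     : ∀ {t u} → ContainsClosed u → ContainsClosed (t · u)
  inBody    : ∀ {x b} → ContainsClosed b → ContainsClosed (ƛ x b)

size : Term → ℕ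
size (var _) = 1
size (t · u) = suc (size t + size u)
size (ƛ _ b) = suc (size b)

fun<app : ∀ t u → size t < size (t · u)
fun<app t u = s≤s (m≤m+n (size t) (size u))

arg<app : ∀ t u → size u < size (t · u)
arg<app t u = s≤s (m≤n+m (size u) (size t))

body<lam : ∀ x b → size b < size (ƛ x b)
body<lam _ b = n<1+n (size b)

subterm-size : ∀ {p q} → Subterm p q → size (proj₂ q) ≤ size (proj₂ p)
subterm-size self = ≤-refl
subterm-size {_ , t · u} (appL _ _ sub) = <⇒≤ (≤-<-trans (subterm-size sub) (fun<app t u))
subterm-size {_ , t · u} (appR _ _ sub) = <⇒≤ (≤-<-trans (subterm-size sub) (arg<app t u))
subterm-size {_ , ƛ x b} (lamB _ sub)   = <⇒≤ (≤-<-trans (subterm-size sub) (body<lam x b))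

smaller⇒proper : ∀ {Γ Δ t s} {q : Context × Term} → Subterm (Δ , s) q → size s < size t → q ≢ (Γ , t)
smaller⇒proper sub s<t refl = <-irrefl refl (≤-<-trans (subterm-size sub) s<t)

app-inversion : ∀ {Γ t u} → Γ ⊢ (t · u) → Σ[ Γ₁ ∈ Context ] Σ[ Γ₂ ∈ Context ] Γ₁ ⊢ t × Γ₂ ⊢ u
app-inversion (app d₁ d₂ _) = _ , _ , d₁ , d₂
app-inversion (exch d)      = app-inversion d

ƛ-inversion : ∀ {Γ x b} → Γ ⊢ ƛ x b → (Γ ++ [ x ]) ⊢ b
ƛ-inversion (lam d) = d
ƛ-inversion {x = x} {b = b} (exch {Γ = Γ} {Δ = Δ} {x = y} {y = z} d) =
  subst (_⊢ b) (sym (++-assoc Γ (y ∷ z ∷ Δ) [ x ]))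
    (exch {Γ = Γ} {Δ = Δ ++ [ x ]} (subst (_⊢ b) (++-assoc Γ (z ∷ y ∷ Δ) [ x ]) (ƛ-inversion d)))

containsClosed⇒decomposable : ∀ {Γ t} → Γ ⊢ t → ContainsClosed t → Decomposable (Γ , t)
containsClosed⇒decomposable {t = t · u} d c with app-inversion d | c
... | _ , _ , d₁ , d₂ | closedFun h = t , appL h d₂ self , smaller⇒proper self (fun<app t u)
... | _ , _ , d₁ , d₂ | closedArg h = u , appR d₁ h self , smaller⇒proper self (arg<app t u)
... | _ , _ , d₁ , d₂ | inFun c₁ with containsClosed⇒decomposable d₁ c₁
...   | s , sub , _ = s , appL d₁ d₂ sub , smaller⇒proper sub (fun<app t u)
containsClosed⇒decomposable {t = t · u} d c | _ , _ , d₁ , d₂ | inArg c₂ with containsClosed⇒decomposable d₂ c₂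
...   | s , sub , _ = s , appR d₁ d₂ sub , smaller⇒proper sub (arg<app t u)
containsClosed⇒decomposable {t = ƛ x b} d (inBody c) with containsClosed⇒decomposable (ƛ-inversion d) c
... | s , sub , _ = s , lamB (ƛ-inversion d) sub , smaller⇒proper sub (body<lam x b)

data Reaches (t : Term) (Allowed : Elem t → Set) (x : Elem t) : Set where
  to-root    : Walk t Allowed x nothing → Reaches t Allowed x
  to-freeVar : ∀ {z w} → freeVarAt t z ≡ just w → Walk t Allowed x z → Reaches t Allowed x

reaches-mono : ∀ {t A B} → (∀ x → A x → B x) → ∀ {x} → Reaches t A x → Reaches t B x
reaches-mono A⊆B (to-root p)       = to-root (walk-mono A⊆B p)
reaches-mono A⊆B (to-freeVar fz p) = to-freeVar fz (walk-mono A⊆B p)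

OnRootEdge : ∀ t → Elem t → Set
OnRootEdge t E = E ≡ nothing ⊎ E ≡ eTerm t nothing

rootEdge? : ∀ t (E : Elem t) → OnRootEdge t E ⊎ OffRootEdge t E
rootEdge? t       nothing        = inj₁ (inj₁ refl)
rootEdge? (var _) (just ())
rootEdge? (t · u) (just app-c)   = inj₁ (inj₂ refl)
rootEdge? (t · u) (just app-f)   = inj₂ ((λ ()) , (λ ()))
rootEdge? (t · u) (just app-a)   = inj₂ ((λ ()) , (λ ()))
rootEdge? (t · u) (just (inL _)) = inj₂ ((λ ()) , (λ ()))
rootEdge? (t · u) (just (inR _)) = inj₂ ((λ ()) , (λ ()))
rootEdge? (ƛ y b) (just lam-ρ)   = inj₁ (inj₂ refl)
rootEdge? (ƛ y b) (just lam-π)   = inj₂ ((λ ()) , (λ ()))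
rootEdge? (ƛ y b) (just lam-β)   = inj₂ ((λ ()) , (λ ()))
rootEdge? (ƛ y b) (just (inB _)) = inj₂ ((λ ()) , (λ ()))

offRootEdge⇒offEdge : ∀ {t E} → OnRootEdge t E → ∀ x → OffRootEdge t x → OffEdge t E x
offRootEdge⇒offEdge (inj₁ refl) _ off = off
offRootEdge⇒offEdge {t} (inj₂ refl) _ (x≢r , x≢er) = x≢er , λ x≡eer → x≢r (trans x≡eer (eTerm-rootPartner t))

root-offEdge : ∀ {Γ t E} → Γ ⊢ t → OffRootEdge t E → OffEdge t E nothing
root-offEdge {t = t} {E} d (E≢r , E≢er) =
  (λ r≡E → E≢r (sym r≡E)) , (λ r≡eE → E≢er (trans (sym (eTerm-involutive d E)) (cong (eTerm t) (sym r≡eE))))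

open-reaches : ∀ {Γ t w} → Γ ⊢ t → w ∈ Γ → ∀ x → Reaches t (OffRootEdge t) x
open-reaches d w∈ nothing  = to-root ε
open-reaches {t = t} d w∈ (just n) with context-var-occurs d w∈
... | z , fz = to-freeVar fz (node↝rootPartner t n ▸ walk-sym (freeVar↝rootPartner t z fz))

open-context : ∀ {Γ t} → Γ ⊢ t → ¬ [] ⊢ t → ∃ λ w → w ∈ Γ
open-context {[]}    d ¬closed = ⊥-elim (¬closed d)
open-context {w ∷ _} _ _       = w , here refl

module _ {t u : Term} {B : Elem (t · u) → Set} (root-ok : B nothing) where

  c↝root : Walk (t · u) B (just app-c) nothing
  c↝root = walk-sym (e-step nothing root-ok)

  liftL-reaches : ∀ {A} → (∀ m → A m → B (liftL m)) → ∀ {x} → Reaches t A x → Reaches (t · u) B (liftL x)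
  liftL-reaches allowed (to-root p)           = to-root (liftL-walk allowed p ▸ v-step (just app-f) ▸ c↝root)
  liftL-reaches allowed (to-freeVar {z} fz p) = to-freeVar (trans (freeVarAt-liftL z) fz) (liftL-walk allowed p)

  liftR-reaches : ∀ {A} → (∀ m → A m → B (liftR m)) → ∀ {x} → Reaches u A x → Reaches (t · u) B (liftR x)
  liftR-reaches allowed (to-root p)           = to-root (liftR-walk allowed p ▸ walk-sym (v-step (just app-c)) ▸ c↝root)
  liftR-reaches allowed (to-freeVar {z} fz p) = to-freeVar (trans (freeVarAt-liftR z) fz) (liftR-walk allowed p)

app-reaches : ∀ {t u} → (∀ E x → Reaches t (OffEdge t E) x) → (∀ E x → Reaches u (OffEdge u E) x) →
  ∀ {E} → OffEdge (t · u) E nothing → OffRootEdge (t · u) E → ∀ x → Reaches (t · u) (OffEdge (t · u) E) x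
app-reaches {t} {u} reaches-t reaches-u {E} root-ok (E≢r , E≢c) x with appView E | appView x
... | outer  | _     = ⊥-elim (E≢r refl)
... | cont   | _     = ⊥-elim (E≢c refl)
... | _      | outer = to-root ε
... | _      | cont  = to-root (c↝root root-ok)
... | fun E₁ | fun m = liftL-reaches root-ok offL (reaches-t E₁ m)
  where
  offL : ∀ m → OffEdge t E₁ m → OffEdge (t · u) (liftL E₁) (liftL m)
  offL m (m≢E , m≢eE) = m≢E ∘ liftL-injective , m≢eE ∘ liftL-injective ∘ λ eq → trans eq (eTerm-liftL E₁)
... | fun E₁ | arg m = liftR-reaches root-ok offR (to-root (↝root u m))
  where
  offR : ∀ m → U m → OffEdge (t · u) (liftL E₁) (liftR m)
  offR m _ = (λ eq → liftL≢liftR E₁ m (sym eq)) , λ eq → liftL≢liftR (eTerm t E₁) m (sym (trans eq (eTerm-liftL E₁)))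
... | arg E₂ | fun m = liftL-reaches root-ok offL (to-root (↝root t m))
  where
  offL : ∀ m → U m → OffEdge (t · u) (liftR E₂) (liftL m)
  offL m _ = liftL≢liftR m E₂ , λ eq → liftL≢liftR m (eTerm u E₂) (trans eq (eTerm-liftR E₂))
... | arg E₂ | arg m = liftR-reaches root-ok offR (reaches-u E₂ m)
  where
  offR : ∀ m → OffEdge u E₂ m → OffEdge (t · u) (liftR E₂) (liftR m)
  offR m (m≢E , m≢eE) = m≢E ∘ liftR-injective , m≢eE ∘ liftR-injective ∘ λ eq → trans eq (eTerm-liftR E₂)

module _ {y : Var} {b : Term} {B : Elem (ƛ y b) → Set} (root-ok : B nothing) where

  ρ↝root : Walk (ƛ y b) B (just lam-ρ) nothing
  ρ↝root = walk-sym (e-step nothing root-ok)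

  π↝root : Walk (ƛ y b) B (just lam-π) nothing
  π↝root = walk-sym (v-step (just lam-ρ)) ▸ ρ↝root

  β↝root : Walk (ƛ y b) B (just lam-β) nothing
  β↝root = v-step (just lam-β) ▸ ρ↝root

  -- An occurrence of the bound variable is joined to π, which is next to the root.
  liftB-reaches : ∀ {A} → (∀ m → A m → freeVarAt b m ≢ just y → B (liftB m)) →
    (∀ z → freeVarAt b z ≡ just y → B (liftB z)) → ∀ {x} → Reaches b A x → Reaches (ƛ y b) B (liftB x)
  liftB-reaches allowed _ (to-root p) = to-root (liftB-walk allowed p ▸ β↝root)
  liftB-reaches allowed bound-ok (to-freeVar {z} {w} fz p) with w ≟ y
  ... | yes refl = to-root (liftB-walk allowed p ▸ e-step (liftB z) (bound-ok z fz)
                            ▸ ≡⇒walk (eTerm-liftB-bound y b z fz) ▸ π↝root)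
  ... | no w≢y   = to-freeVar (freeVarAt-liftB y b z fz w≢y) (liftB-walk allowed p)

lam-reaches : ∀ {Γ y b} → (Γ ++ [ y ]) ⊢ b → (∀ E x → Reaches b (OffEdge b E) x) →
  ∀ {E} → OffEdge (ƛ y b) E nothing → OffRootEdge (ƛ y b) E → ∀ x → Reaches (ƛ y b) (OffEdge (ƛ y b) E) x
lam-reaches {y = y} {b} d reaches-b {E} root-ok (E≢r , E≢ρ) x with lamView E | lamView x
... | outer   | _      = ⊥-elim (E≢r refl)
... | ρ       | _      = ⊥-elim (E≢ρ refl)
... | _       | outer  = to-root ε
... | _       | ρ      = to-root (ρ↝root root-ok)
... | _       | π      = to-root (π↝root root-ok)
... | π       | body m = to-root (liftB-walk off-π (↝root b m) ▸ β↝root root-ok)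
  where
  off-π : ∀ m → U m → freeVarAt b m ≢ just y → OffEdge (ƛ y b) (just lam-π) (liftB m)
  off-π m _ free with paramView y b
  ... | unused _ eπ     = liftB≢π m , λ eq → liftB≢π m (trans eq eπ)
  ... | used m₀ fm₀ eπ = liftB≢π m , λ eq → free (subst (λ k → freeVarAt b k ≡ just y)
                                                     (sym (liftB-injective (trans eq eπ))) fm₀)
... | body E₀ | body m with freeVarAt? b E₀ y
...   | yes bound = to-root (liftB-walk off-binding (↝root b m) ▸ β↝root root-ok)
  where
  off-binding : ∀ m → U m → freeVarAt b m ≢ just y → OffEdge (ƛ y b) (liftB E₀) (liftB m)
  off-binding m _ free = (λ eq → free (subst (λ k → freeVarAt b k ≡ just y) (sym (liftB-injective eq)) bound))
                       , λ eq → liftB≢π m (trans eq (eTerm-liftB-bound y b E₀ bound))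
...   | no free = liftB-reaches root-ok off-free off-bound (reaches-b E₀ m)
  where
  eE : eTerm (ƛ y b) (liftB E₀) ≡ liftB (eTerm b E₀)
  eE = eTerm-liftB-free y b E₀ free
  off-free : ∀ m → OffEdge b E₀ m → freeVarAt b m ≢ just y → OffEdge (ƛ y b) (liftB E₀) (liftB m)
  off-free m (m≢E , m≢eE) _ = m≢E ∘ liftB-injective , m≢eE ∘ liftB-injective ∘ λ eq → trans eq eE
  -- e fixes the occurrence z, so z = e E₀ would force E₀ = z, which is free.
  off-bound : ∀ z → freeVarAt b z ≡ just y → OffEdge (ƛ y b) (liftB E₀) (liftB z)
  off-bound z fz = (λ eq → free (subst (λ k → freeVarAt b k ≡ just y) (liftB-injective eq) fz))
                 , λ eq → free (subst (λ k → freeVarAt b k ≡ just y) (E₀≡z (liftB-injective (trans eq eE))) fz)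
    where
    E₀≡z : z ≡ eTerm b E₀ → z ≡ E₀
    E₀≡z z≡eE = trans (sym (eTerm-fixes-freeVar b z fz)) (trans (cong (eTerm b) z≡eE) (eTerm-involutive d E₀))

-- Generalised so that the edge may be the root edge as long as the term is open; this is what makes
-- the induction go through, since an immediate subterm of a term without closed subterms is open.
mutual
  reaches : ∀ {Γ t} → Γ ⊢ t → ¬ ContainsClosed t → ∀ {E} → OffRootEdge t E ⊎ (∃ λ w → w ∈ Γ) →
    ∀ x → Reaches t (OffEdge t E) x
  reaches {t = t} d no-closed {E} hyp x with rootEdge? t E | hyp
  ... | inj₂ off         | _               = reaches-off d no-closed off x
  ... | inj₁ on          | inj₂ (_ , w∈)   = reaches-mono (offRootEdge⇒offEdge on) (open-reaches d w∈ x)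
  ... | inj₁ (inj₁ E≡r)  | inj₁ (E≢r , _)  = ⊥-elim (E≢r E≡r)
  ... | inj₁ (inj₂ E≡er) | inj₁ (_ , E≢er) = ⊥-elim (E≢er E≡er)

  reaches-off : ∀ {Γ t} → Γ ⊢ t → ¬ ContainsClosed t → ∀ {E} → OffRootEdge t E →
    ∀ x → Reaches t (OffEdge t E) x
  reaches-off ax _ {nothing} (E≢r , _) = ⊥-elim (E≢r refl)
  reaches-off (exch d) no-closed off = reaches-off d no-closed off
  reaches-off d@(app d₁ d₂ _) no-closed off = app-reaches
    (λ _ → reaches d₁ (no-closed ∘ inFun) (inj₂ (open-context d₁ (no-closed ∘ closedFun))))
    (λ _ → reaches d₂ (no-closed ∘ inArg) (inj₂ (open-context d₂ (no-closed ∘ closedArg))))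
    (root-offEdge d off) off
  reaches-off d@(lam {Γ = Γ} {x = y} d₀) no-closed off = lam-reaches d₀
    (λ _ → reaches d₀ (no-closed ∘ inBody) (inj₂ (y , ∈-++⁺ʳ Γ (here refl))))
    (root-offEdge d off) off

indecomposable⇒connected : ∀ {t} → [] ⊢ t → Indecomposable ([] , t) →
  ∀ {E} → OffRootEdge t E → ConnectedOff t E
indecomposable⇒connected {t} d indec {E} off x y = reach-root x ▸ walk-sym (reach-root y)
  where
  reach-root : ∀ x → Walk t (OffEdge t E) x nothing
  reach-root x with reaches d (indec ∘ containsClosed⇒decomposable d) (inj₁ off) x
  ... | to-root p          = p
  ... | to-freeVar {z} fz _ = ⊥-elim (nothing≢just (trans (sym (closed⇒noFreeVar d z)) fz))

indecomposable⇒bridgeless : ∀ {t} → [] ⊢ t → Indecomposable ([] , t) → TermBridgeless t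
indecomposable⇒bridgeless d indec E (off , disconnected) = disconnected (indecomposable⇒connected d indec off)

-- Transport along the isomorphism

module _ {t : Term} {M : ClosedRootedTrivalentMap} (iso : UnderlyingMapIso t M) where
  open ClosedRootedTrivalentMap M
  open UnderlyingMapIso iso
  open Inverse φ using (to; from; strictlyInverseˡ; strictlyInverseʳ)

  to-injective : ∀ {a b} → to a ≡ to b → a ≡ b
  to-injective {a} {b} eq = trans (sym (strictlyInverseʳ a)) (trans (cong from eq) (strictlyInverseʳ b))

  to-offEdge : ∀ {E x} → OffEdge t E x → NotOnEdge M (to E) (to x)
  to-offEdge {E} (x≢E , x≢eE) = x≢E ∘ to-injective , x≢eE ∘ to-injective ∘ λ eq → trans eq (sym (comm-e E))

  from-notOnEdge : ∀ {E x} → NotOnEdge M (to E) x → OffEdge t E (from x)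
  from-notOnEdge {E} {x} (x≢E , x≢eE) =
    (λ eq → x≢E (trans (sym (strictlyInverseˡ x)) (cong to eq))) ,
    (λ eq → x≢eE (trans (sym (strictlyInverseˡ x)) (trans (cong to eq) (comm-e E))))

  to-walk : ∀ {E a b} → Walk t (OffEdge t E) a b → EqClosure (StepWithout M (to E)) (to a) (to b)
  to-walk = EqClosure.gmap to step
    where
    step : ∀ {E a b} → Step t (OffEdge t E) a b → StepWithout M (to E) (to a) (to b)
    step {a = a} (inj₁ refl)         = inj₁ (comm-v a)
    step {a = a} (inj₂ (refl , off)) = inj₂ (comm-e a , to-offEdge off)

  from-walk : ∀ {E a b} → EqClosure (StepWithout M (to E)) a b → Walk t (OffEdge t E) (from a) (from b)
  from-walk = EqClosure.gmap from step
    where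
    from-comm : ∀ f g → (∀ x → to (f x) ≡ g (to x)) → ∀ a → from (g a) ≡ f (from a)
    from-comm f g comm a = trans (cong (from ∘ g) (sym (strictlyInverseˡ a)))
                                 (trans (cong from (sym (comm (from a)))) (strictlyInverseʳ (f (from a))))
    step : ∀ {E a b} → StepWithout M (to E) a b → Step t (OffEdge t E) (from a) (from b)
    step {a = a} (inj₁ refl)         = inj₁ (from-comm (vTerm t) v comm-v a)
    step {a = a} (inj₂ (refl , off)) = inj₂ (from-comm (eTerm t) e comm-e a , from-notOnEdge off)

  isBridge⇔ : ∀ E → IsBridge M (to E) ⇔ IsBridgeOf t E
  isBridge⇔ E = mk⇔
    (λ (notOnRoot , disconnected) → offRootEdge notOnRoot , disconnected ∘ connectedWithout)
    (λ (off , disconnected) → subst (λ r′ → NotOnEdge M r′ (to E)) root (to-offEdge off) ,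
                              disconnected ∘ connectedOff)
    where
    offRootEdge : NotOnEdge M r (to E) → OffRootEdge t E
    offRootEdge notOnRoot = subst (OffRootEdge t) (strictlyInverseʳ E)
      (from-notOnEdge (subst (λ r′ → NotOnEdge M r′ (to E)) (sym root) notOnRoot))
    connectedWithout : ConnectedOff t E → ConnectedWithout M (to E)
    connectedWithout connected x y = subst₂ (EqClosure (StepWithout M (to E)))
      (strictlyInverseˡ x) (strictlyInverseˡ y) (to-walk (connected (from x) (from y)))
    connectedOff : ConnectedWithout M (to E) → ConnectedOff t E
    connectedOff connected a b = subst₂ (Walk t (OffEdge t E))
      (strictlyInverseʳ a) (strictlyInverseʳ b) (from-walk (connected (to a) (to b)))

  bridgeless⇔ : Bridgeless M ⇔ TermBridgeless t
  bridgeless⇔ = mk⇔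
    (λ bridgeless E → bridgeless (to E) ∘ Equivalence.from (isBridge⇔ E))
    (λ bridgeless m → bridgeless (from m) ∘ Equivalence.to (isBridge⇔ (from m))
                      ∘ subst (IsBridge M) (sym (strictlyInverseˡ m)))

proposition3 : (M : ClosedRootedTrivalentMap) (t : Term) → [] ⊢ t →
    UnderlyingMapIso t M → (Bridgeless M ⇔ Indecomposable ([] , t))
proposition3 M t d iso =
  ⇔.trans (bridgeless⇔ iso) (mk⇔ (bridgeless⇒indecomposable d) (indecomposable⇒bridgeless d))
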